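{- Let $n\ge 1$. For an $n\times n$ magog matrix $A=(a_{i,j})_{1\le i,j\le n}$, define the $(n+1)\times(n+1)$ matrix $c(A)=(c_{i,j})_{0\le i,j\le n}$ by $c_{i,j}=\sum_{i'=1}^{i}\sum_{j'=1}^{j}a_{i',j'}$ (empty sums are $0$). Then $A\mapsto c(A)$ is an explicit bijection from the set $\mathrm{Magog}_n$ of $n\times n$ magog matrices onto the set of magog corner-sum matrices of order $n$.
   Context: An $n\times n$ square sign matrix is a matrix $A=(a_{i,j})$ with entries in $\{0,1,-1\}$ such that every row sums to $1$, every column sums to $1$, every partial column sum $\sum_{i'=1}^{i}a_{i',j}$ lies in $\{0,1\}$ (for all $i,j$), and every partial row sum $\sum_{j'=1}^{j}a_{i,j'}$ is $\ge 0$ (for all $i,j$). A magog matrix of order $n$ is an $n\times n$ square sign matrix that additionally satisfies, for all $1\le i\le n-2$ and $1\le j\le n-2$, the special inequality $\sum_{j'=1}^{j}a_{i+1,j'}+\sum_{i'=1}^{i+1}a_{i',j+1}-\sum_{i'=1}^{i}a_{i',j}\ge 0$. A magog corner-sum matrix of order $n$ is an integer matrix $(c_{i,j})_{0\le i,j\le n}$ such that: $c_{0,k}=c_{k,0}=0$ and $c_{n,k}=c_{k,n}=k$ for all $0\le k\le n$; $c_{i,j}-c_{i,j-1}\in\{0,1\}$ for all $0\le i\le n$, $1\le j\le n$; $c_{i,j}\ge c_{i-1,j}$ for all $1\le i\le n$, $0\le j\le n$; and (special inequality) $c_{i+1,j+1}+c_{i,j-1}\ge 2c_{i,j}$ for all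 $1\le i\le n-2$, $1\le j\le n-2$. -}

module Defs where

open import Data.Nat as ℕ using (ℕ; zero; suc; _<?_)
open import Data.Integer as ℤ using (ℤ; 0ℤ; 1ℤ; -1ℤ; _+_; _-_; _≤_)
open import Data.Fin using (Fin; toℕ; fromℕ<)
open import Data.Product using (_×_; Σ; ∃-syntax; _,_)
open import Data.Sum using (_⊎_)
open import Relation.Nullary using (yes; no)
open import Relation.Binary.PropositionalEquality using (_≡_)

-- An n×n matrix with integer entries, stored 0-based: A i j = a_{i+1,j+1}.
Matrix : ℕ → Set
Matrix n = Fin n → Fin n → ℤ

-- 1-based access: entry n A i j = a_{i,j} for 1 ≤ i,j ≤ n, and 0 otherwise.
entry : (n : ℕ) → Matrix n → ℕ → ℕ → ℤ
entry n A zero j = 0ℤ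
entry n A (suc i) zero = 0ℤ
entry n A (suc i) (suc j) with i <? n | j <? n
... | yes p | yes q = A (fromℕ< p) (fromℕ< q)
... | _ | _ = 0ℤ

sumTo : ℕ → (ℕ → ℤ) → ℤ
sumTo zero f = 0ℤ
sumTo (suc m) f = sumTo m f + f (suc m)

colPart : (n : ℕ) → Matrix n → ℕ → ℕ → ℤ
colPart n A i j = sumTo i (λ i' → entry n A i' j)

rowPart : (n : ℕ) → Matrix n → ℕ → ℕ → ℤ
rowPart n A i j = sumTo j (λ j' → entry n A i j')

IsSquareSignMatrix : (n : ℕ) → Matrix n → Set
IsSquareSignMatrix n A =
  (∀ i j → A i j ≡ 0ℤ ⊎ A i j ≡ 1ℤ ⊎ A i j ≡ -1ℤ)
  × (∀ i → 1 ℕ.≤ i → i ℕ.≤ n → rowPart n A i n ≡ 1ℤ)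
  × (∀ j → 1 ℕ.≤ j → j ℕ.≤ n → colPart n A n j ≡ 1ℤ)
  × (∀ i j → 1 ℕ.≤ i → i ℕ.≤ n → 1 ℕ.≤ j → j ℕ.≤ n →
       colPart n A i j ≡ 0ℤ ⊎ colPart n A i j ≡ 1ℤ)
  × (∀ i j → 1 ℕ.≤ i → i ℕ.≤ n → 1 ℕ.≤ j → j ℕ.≤ n →
       0ℤ ≤ rowPart n A i j)

IsMagog : (n : ℕ) → Matrix n → Set
IsMagog n A =
  IsSquareSignMatrix n A
  × (∀ i j → 1 ℕ.≤ i → i ℕ.≤ n ℕ.∸ 2 → 1 ℕ.≤ j → j ℕ.≤ n ℕ.∸ 2 →
       0ℤ ≤ (rowPart n A (suc i) j + colPart n A (suc i) (suc j)) - colPart n A i j)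

CMatrix : ℕ → Set
CMatrix n = Fin (suc n) → Fin (suc n) → ℤ

-- c-access: centry n C i j = c_{i,j} for 0 ≤ i,j ≤ n, 0 otherwise (never used out of range)
centry : (n : ℕ) → CMatrix n → ℕ → ℕ → ℤ
centry n C i j with i <? suc n | j <? suc n
... | yes p | yes q = C (fromℕ< p) (fromℕ< q)
... | _ | _ = 0ℤ

IsMagogCornerSum : (n : ℕ) → CMatrix n → Set
IsMagogCornerSum n C =
  (∀ k → k ℕ.≤ n → centry n C 0 k ≡ 0ℤ × centry n C k 0 ≡ 0ℤ)
  × (∀ k → k ℕ.≤ n → centry n C n k ≡ ℤ.+ k × centry n C k n ≡ ℤ.+ k)
  × (∀ i j → i ℕ.≤ n → 1 ℕ.≤ j → j ℕ.≤ n →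
       centry n C i j - centry n C i (j ℕ.∸ 1) ≡ 0ℤ
       ⊎ centry n C i j - centry n C i (j ℕ.∸ 1) ≡ 1ℤ)
  × (∀ i j → 1 ℕ.≤ i → i ℕ.≤ n → j ℕ.≤ n →
       centry n C (i ℕ.∸ 1) j ≤ centry n C i j)
  × (∀ i j → 1 ℕ.≤ i → i ℕ.≤ n ℕ.∸ 2 → 1 ℕ.≤ j → j ℕ.≤ n ℕ.∸ 2 →
       ℤ.+ 2 ℤ.* centry n C i j ≤ centry n C (suc i) (suc j) + centry n C i (j ℕ.∸ 1))

cornerSum : (n : ℕ) → Matrix n → CMatrix n
cornerSum n A i j = sumTo (toℕ i) (λ i' → sumTo (toℕ j) (λ j' → entry n A i' j'))

Magog : ℕ → Set
Magog n = Σ (Matrix n) (IsMagog n)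

MagogCornerSum : ℕ → Set
MagogCornerSum n = Σ (CMatrix n) (IsMagogCornerSum n)

_≐_ : ∀ {n} → Matrix n → Matrix n → Set
A ≐ B = ∀ i j → A i j ≡ B i j

_≐ᶜ_ : ∀ {n} → CMatrix n → CMatrix n → Set
C ≐ᶜ D = ∀ i j → C i j ≡ D i j

record CornerSumBijection (n : ℕ) : Set where
  field
    maps-into  : ∀ (A : Matrix n) → IsMagog n A → IsMagogCornerSum n (cornerSum n A)
    injective  : ∀ (A B : Matrix n) → IsMagog n A → IsMagog n B →
                   cornerSum n A ≐ᶜ cornerSum n B → A ≐ B
    surjective : ∀ (C : CMatrix n) → IsMagogCornerSum n C →
                   Σ (Matrix n) (λ A → IsMagog n A × cornerSum n A ≐ᶜ C)

-- Corner sums and second differences are mutually inverse (a discrete fundamental theorem of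
-- calculus), and under this correspondence the partial row and column sums of A are first
-- differences of c = c(A). Each magog condition therefore translates into a corner-sum
-- condition: full row and column sums 1 become the borders c(n,k) = c(k,n) = k, partial column
-- sums in {0,1} become row increments in {0,1}, nonnegative partial row sums become
-- monotonicity down columns, and the special inequality of A is literally the special
-- inequality c(i+1,j+1) + c(i,j-1) - 2c(i,j) ≥ 0 of c. Conversely, the entries of the second
-- difference of a corner-sum matrix lie in {0,1,-1}, being differences of two increments in {0,1}.
module Submission where

open import Defs
open import Data.Nat using (ℕ; _≤_)
open import Data.Nat as ℕ using (zero; suc; _<_; _<?_; _∸_; z≤n; s≤s)
import Data.Nat.Properties as ℕ
open import Data.Integer as ℤ using (ℤ; 0ℤ; 1ℤ; -1ℤ; +_; _+_; _-_; _*_)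
import Data.Integer.Properties as ℤ
open import Data.Integer.Tactic.RingSolver using (solve-∀)
open import Algebra.Properties.AbelianGroup ℤ.+-0-abelianGroup using (xyx⁻¹≈y)
open import Data.Fin using (Fin; toℕ; fromℕ<)
open import Data.Fin.Properties using (toℕ<n; fromℕ<-toℕ; toℕ-fromℕ<)
open import Data.Product using (_×_; _,_; proj₁; proj₂)
open import Data.Sum using (_⊎_; inj₁; inj₂)
open import Relation.Nullary using (yes; no)
open import Relation.Nullary.Negation using (contradiction)
open import Relation.Binary.PropositionalEquality
open ≡-Reasoning

IsBit : ℤ → Set
IsBit x = x ≡ 0ℤ ⊎ x ≡ 1ℤ

IsSign : ℤ → Set
IsSign x = x ≡ 0ℤ ⊎ x ≡ 1ℤ ⊎ x ≡ -1ℤ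

bit-difference-isSign : ∀ {u v} → IsBit u → IsBit v → IsSign (u - v)
bit-difference-isSign (inj₁ refl) (inj₁ refl) = inj₁ refl
bit-difference-isSign (inj₁ refl) (inj₂ refl) = inj₂ (inj₂ refl)
bit-difference-isSign (inj₂ refl) (inj₁ refl) = inj₂ (inj₁ refl)
bit-difference-isSign (inj₂ refl) (inj₂ refl) = inj₁ refl

+[1+n]-+n≡1 : ∀ n → + suc n - + n ≡ 1ℤ
+[1+n]-+n≡1 n = cancel (+ n)
  where
  cancel : ∀ x → (1ℤ + x) - x ≡ 1ℤ
  cancel = solve-∀

≤∸2⇒< : ∀ {i n} → 1 ≤ i → i ≤ n ∸ 2 → i < n
≤∸2⇒< {n = suc (suc n)} _ i≤n = s≤s (ℕ.m≤n⇒m≤1+n i≤n)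
≤∸2⇒< {n = zero}        (s≤s z≤n) ()
≤∸2⇒< {n = suc zero}    (s≤s z≤n) ()

sumTo-0 : ∀ m → sumTo m (λ _ → 0ℤ) ≡ 0ℤ
sumTo-0 zero    = refl
sumTo-0 (suc m) = cong (_+ 0ℤ) (sumTo-0 m)

sumTo-1 : ∀ m → sumTo m (λ _ → 1ℤ) ≡ + m
sumTo-1 zero    = refl
sumTo-1 (suc m) = trans (cong (_+ 1ℤ) (sumTo-1 m)) (cong +_ (ℕ.+-comm m 1))

sumTo-distrib-+ : ∀ m (f g : ℕ → ℤ) → sumTo m (λ k → f k + g k) ≡ sumTo m f + sumTo m g
sumTo-distrib-+ zero    f g = refl
sumTo-distrib-+ (suc m) f g = begin
    sumTo m (λ k → f k + g k) + (f (suc m) + g (suc m))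
  ≡⟨ cong (_+ (f (suc m) + g (suc m))) (sumTo-distrib-+ m f g) ⟩
    (sumTo m f + sumTo m g) + (f (suc m) + g (suc m))
  ≡⟨ interchange (sumTo m f) (sumTo m g) (f (suc m)) (g (suc m)) ⟩
    (sumTo m f + f (suc m)) + (sumTo m g + g (suc m))
  ∎
  where
  interchange : ∀ a b c d → (a + b) + (c + d) ≡ (a + c) + (b + d)
  interchange = solve-∀

sumTo-telescope : ∀ m (f h : ℕ → ℤ) → h 0 ≡ 0ℤ →
                  (∀ {k} → k < m → f (suc k) ≡ h (suc k) - h k) → sumTo m f ≡ h m
sumTo-telescope zero    f h h0≡0 _    = sym h0≡0
sumTo-telescope (suc m) f h h0≡0 step = begin
    sumTo m f + f (suc m)
  ≡⟨ cong₂ _+_ (sumTo-telescope m f h h0≡0 (λ k<m → step (ℕ.m<n⇒m<1+n k<m))) (step ℕ.≤-refl) ⟩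
    h m + (h (suc m) - h m)
  ≡⟨ cancel (h m) (h (suc m)) ⟩
    h (suc m)
  ∎
  where
  cancel : ∀ a b → a + (b - a) ≡ b
  cancel = solve-∀

unit-increments⇒≡+ : ∀ {m} (h : ℕ → ℤ) → h 0 ≡ 0ℤ →
                     (∀ {k} → k < m → h (suc k) - h k ≡ 1ℤ) → ∀ {k} → k ≤ m → h k ≡ + k
unit-increments⇒≡+ h h0≡0 step {k} k≤m = begin
  h k                    ≡⟨ sym (sumTo-telescope k (λ _ → 1ℤ) h h0≡0 (λ j<k → sym (step (ℕ.≤-trans j<k k≤m)))) ⟩
  sumTo k (λ _ → 1ℤ)     ≡⟨ sumTo-1 k ⟩
  + k                    ∎

doubleSum : (ℕ → ℕ → ℤ) → ℕ → ℕ → ℤ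
doubleSum f i j = sumTo i (λ i' → sumTo j (f i'))

doubleSum-sucʳ : ∀ f i j → doubleSum f i (suc j) ≡ doubleSum f i j + sumTo i (λ i' → f i' (suc j))
doubleSum-sucʳ f i j = sumTo-distrib-+ i (λ i' → sumTo j (f i')) (λ i' → f i' (suc j))

secondDifference : (ℕ → ℕ → ℤ) → ℕ → ℕ → ℤ
secondDifference c i j = (c (suc i) (suc j) - c i (suc j)) - (c (suc i) j - c i j)

secondDifference-transpose : ∀ c i j →
  secondDifference c i j ≡ (c (suc i) (suc j) - c (suc i) j) - (c i (suc j) - c i j)
secondDifference-transpose c i j = swap (c (suc i) (suc j)) (c i (suc j)) (c (suc i) j) (c i j)
  where
  swap : ∀ a b c d → (a - b) - (c - d) ≡ (a - c) - (b - d)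
  swap = solve-∀

secondDifference-cong : ∀ {c d : ℕ → ℕ → ℤ} → (∀ i j → c i j ≡ d i j) →
                        ∀ i j → secondDifference c i j ≡ secondDifference d i j
secondDifference-cong c≗d i j
  rewrite c≗d (suc i) (suc j) | c≗d i (suc j) | c≗d (suc i) j | c≗d i j = refl

entry-fromℕ< : ∀ {n} (A : Matrix n) {i j} (p : i < n) (q : j < n) →
               entry n A (suc i) (suc j) ≡ A (fromℕ< p) (fromℕ< q)
entry-fromℕ< {n} A {i} {j} p q with i <? n | j <? n
... | yes _  | yes _  = refl
... | no i≮n | _      = contradiction p i≮n
... | yes _  | no j≮n = contradiction q j≮n

entry-toℕ : ∀ {n} (A : Matrix n) (x y : Fin n) → entry n A (suc (toℕ x)) (suc (toℕ y)) ≡ A x y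
entry-toℕ A x y =
  trans (entry-fromℕ< A (toℕ<n x) (toℕ<n y)) (cong₂ A (fromℕ<-toℕ x _) (fromℕ<-toℕ y _))

centry-fromℕ< : ∀ {n} (C : CMatrix n) {i j} (p : i < suc n) (q : j < suc n) →
                centry n C i j ≡ C (fromℕ< p) (fromℕ< q)
centry-fromℕ< {n} C {i} {j} p q with i <? suc n | j <? suc n
... | yes _  | yes _  = refl
... | no i≮n | _      = contradiction p i≮n
... | yes _  | no j≮n = contradiction q j≮n

centry-toℕ : ∀ {n} (C : CMatrix n) (x y : Fin (suc n)) → centry n C (toℕ x) (toℕ y) ≡ C x y
centry-toℕ C x y =
  trans (centry-fromℕ< C (toℕ<n x) (toℕ<n y)) (cong₂ C (fromℕ<-toℕ x _) (fromℕ<-toℕ y _))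

centry-cong : ∀ {n} {C D : CMatrix n} → C ≐ᶜ D → ∀ i j → centry n C i j ≡ centry n D i j
centry-cong {n} C≐D i j with i <? suc n | j <? suc n
... | yes _ | yes _ = C≐D _ _
... | no _  | _     = refl
... | yes _ | no _  = refl

doubleSum≡centry-cornerSum : ∀ {n} (A : Matrix n) {i j} → i ≤ n → j ≤ n →
                             doubleSum (entry n A) i j ≡ centry n (cornerSum n A) i j
doubleSum≡centry-cornerSum {n} A {i} {j} i≤n j≤n = sym (begin
    centry n (cornerSum n A) i j
  ≡⟨ centry-fromℕ< (cornerSum n A) (s≤s i≤n) (s≤s j≤n) ⟩
    doubleSum (entry n A) (toℕ (fromℕ< (s≤s i≤n))) (toℕ (fromℕ< (s≤s j≤n)))
  ≡⟨ cong₂ (doubleSum (entry n A)) (toℕ-fromℕ< (s≤s i≤n)) (toℕ-fromℕ< (s≤s j≤n)) ⟩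
    doubleSum (entry n A) i j
  ∎)

module CornerSums {n} (A : Matrix n) (c : ℕ → ℕ → ℤ)
                  (doubleSum≡c : ∀ {i j} → i ≤ n → j ≤ n → doubleSum (entry n A) i j ≡ c i j) where

  private
    e : ℕ → ℕ → ℤ
    e = entry n A

  rowPart≡ : ∀ {i j} → i < n → j ≤ n → rowPart n A (suc i) j ≡ c (suc i) j - c i j
  rowPart≡ {i} {j} i<n j≤n = begin
      rowPart n A (suc i) j
    ≡⟨ sym (xyx⁻¹≈y (doubleSum e i j) (rowPart n A (suc i) j)) ⟩
      doubleSum e (suc i) j - doubleSum e i j
    ≡⟨ cong₂ _-_ (doubleSum≡c i<n j≤n) (doubleSum≡c (ℕ.<⇒≤ i<n) j≤n) ⟩
      c (suc i) j - c i j
    ∎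

  colPart≡ : ∀ {i j} → i ≤ n → j < n → colPart n A i (suc j) ≡ c i (suc j) - c i j
  colPart≡ {i} {j} i≤n j<n = begin
      colPart n A i (suc j)
    ≡⟨ sym (xyx⁻¹≈y (doubleSum e i j) (colPart n A i (suc j))) ⟩
      (doubleSum e i j + colPart n A i (suc j)) - doubleSum e i j
    ≡⟨ cong (_- doubleSum e i j) (sym (doubleSum-sucʳ e i j)) ⟩
      doubleSum e i (suc j) - doubleSum e i j
    ≡⟨ cong₂ _-_ (doubleSum≡c i≤n j<n) (doubleSum≡c i≤n (ℕ.<⇒≤ j<n)) ⟩
      c i (suc j) - c i j
    ∎

  entry≡secondDifference : ∀ {i j} → i < n → j < n → e (suc i) (suc j) ≡ secondDifference c i j
  entry≡secondDifference {i} {j} i<n j<n = begin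
      e (suc i) (suc j)
    ≡⟨ sym (xyx⁻¹≈y (rowPart n A (suc i) j) (e (suc i) (suc j))) ⟩
      rowPart n A (suc i) (suc j) - rowPart n A (suc i) j
    ≡⟨ cong₂ _-_ (rowPart≡ i<n j<n) (rowPart≡ i<n (ℕ.<⇒≤ j<n)) ⟩
      secondDifference c i j
    ∎

  specialExpression≡ : ∀ {i j} → i < n → suc j < n →
    (rowPart n A (suc i) (suc j) + colPart n A (suc i) (suc (suc j))) - colPart n A i (suc j)
    ≡ (c (suc i) (suc (suc j)) + c i j) - + 2 * c i (suc j)
  specialExpression≡ {i} {j} i<n j+1<n = begin
      (rowPart n A (suc i) (suc j) + colPart n A (suc i) (suc (suc j))) - colPart n A i (suc j)
    ≡⟨ cong₂ _-_ (cong₂ _+_ (rowPart≡ i<n (ℕ.<⇒≤ j+1<n)) (colPart≡ i<n j+1<n))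
                 (colPart≡ (ℕ.<⇒≤ i<n) (ℕ.<⇒≤ j+1<n)) ⟩
      ((c (suc i) (suc j) - c i (suc j)) + (c (suc i) (suc (suc j)) - c (suc i) (suc j)))
        - (c i (suc j) - c i j)
    ≡⟨ rearrange (c (suc i) (suc j)) (c i (suc j)) (c (suc i) (suc (suc j))) (c i j) ⟩
      (c (suc i) (suc (suc j)) + c i j) - + 2 * c i (suc j)
    ∎
    where
    rearrange : ∀ a b d f → ((a - b) + (d - a)) - (b - f) ≡ (d + f) - + 2 * b
    rearrange = solve-∀

cornerSum-isMagogCornerSum : ∀ n (A : Matrix n) → IsMagog n A → IsMagogCornerSum n (cornerSum n A)
cornerSum-isMagogCornerSum n A ((_ , rowSums , colSums , colPartBits , rowPartNonneg) , special) =
  zeroBorder , identityBorder , rowIncrements , columnMonotone , convexity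
  where
  c : ℕ → ℕ → ℤ
  c = centry n (cornerSum n A)
  open CornerSums A c (doubleSum≡centry-cornerSum A)

  zeroBorder : ∀ k → k ≤ n → c 0 k ≡ 0ℤ × c k 0 ≡ 0ℤ
  zeroBorder k k≤n =
    sym (doubleSum≡centry-cornerSum A z≤n k≤n) ,
    trans (sym (doubleSum≡centry-cornerSum A k≤n z≤n)) (sumTo-0 k)

  identityBorder : ∀ k → k ≤ n → c n k ≡ + k × c k n ≡ + k
  identityBorder k k≤n =
    unit-increments⇒≡+ (c n) (proj₂ (zeroBorder n ℕ.≤-refl))
      (λ j<n → trans (sym (colPart≡ ℕ.≤-refl j<n)) (colSums _ (s≤s z≤n) j<n)) k≤n ,
    unit-increments⇒≡+ (λ i → c i n) (proj₁ (zeroBorder n ℕ.≤-refl))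
      (λ i<n → trans (sym (rowPart≡ i<n ℕ.≤-refl)) (rowSums _ (s≤s z≤n) i<n)) k≤n

  rowIncrements : ∀ i j → i ≤ n → 1 ≤ j → j ≤ n → IsBit (c i j - c i (j ∸ 1))
  rowIncrements i (suc j) i≤n (s≤s z≤n) j<n = subst IsBit (colPart≡ i≤n j<n) (colPartBit i i≤n)
    where
    colPartBit : ∀ i → i ≤ n → IsBit (colPart n A i (suc j))
    colPartBit zero    _   = inj₁ refl
    colPartBit (suc i) i<n = colPartBits (suc i) (suc j) (s≤s z≤n) i<n (s≤s z≤n) j<n

  columnMonotone : ∀ i j → 1 ≤ i → i ≤ n → j ≤ n → c (i ∸ 1) j ℤ.≤ c i j
  columnMonotone (suc i) j (s≤s z≤n) i<n j≤n =
    ℤ.0≤i-j⇒j≤i (subst (0ℤ ℤ.≤_) (rowPart≡ i<n j≤n) (rowPartNonneg′ j j≤n))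
    where
    rowPartNonneg′ : ∀ j → j ≤ n → 0ℤ ℤ.≤ rowPart n A (suc i) j
    rowPartNonneg′ zero    _   = ℤ.≤-refl
    rowPartNonneg′ (suc j) j<n = rowPartNonneg (suc i) (suc j) (s≤s z≤n) i<n (s≤s z≤n) j<n

  convexity : ∀ i j → 1 ≤ i → i ≤ n ∸ 2 → 1 ≤ j → j ≤ n ∸ 2 →
              + 2 * c i j ℤ.≤ c (suc i) (suc j) + c i (j ∸ 1)
  convexity i (suc j) 1≤i i≤n-2 1≤j j≤n-2 =
    ℤ.0≤i-j⇒j≤i (subst (0ℤ ℤ.≤_) (specialExpression≡ (≤∸2⇒< 1≤i i≤n-2) (≤∸2⇒< 1≤j j≤n-2))
                                  (special i (suc j) 1≤i i≤n-2 1≤j j≤n-2))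

cornerSum-injective : ∀ n (A B : Matrix n) → cornerSum n A ≐ᶜ cornerSum n B → A ≐ B
cornerSum-injective n A B cA≐cB x y = begin
    A x y
  ≡⟨ sym (entry-toℕ A x y) ⟩
    entry n A (suc i) (suc j)
  ≡⟨ CornerSums.entry≡secondDifference A _ (doubleSum≡centry-cornerSum A) i<n j<n ⟩
    secondDifference (centry n (cornerSum n A)) i j
  ≡⟨ secondDifference-cong (centry-cong cA≐cB) i j ⟩
    secondDifference (centry n (cornerSum n B)) i j
  ≡⟨ sym (CornerSums.entry≡secondDifference B _ (doubleSum≡centry-cornerSum B) i<n j<n) ⟩
    entry n B (suc i) (suc j)
  ≡⟨ entry-toℕ B x y ⟩
    B x y
  ∎
  where
  i = toℕ x
  j = toℕ y
  i<n = toℕ<n x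
  j<n = toℕ<n y

cornerDifferences : ∀ n → (ℕ → ℕ → ℤ) → Matrix n
cornerDifferences n c x y = secondDifference c (toℕ x) (toℕ y)

doubleSum-cornerDifferences : ∀ n (c : ℕ → ℕ → ℤ) → (∀ k → k ≤ n → c 0 k ≡ 0ℤ × c k 0 ≡ 0ℤ) →
  ∀ {i j} → i ≤ n → j ≤ n → doubleSum (entry n (cornerDifferences n c)) i j ≡ c i j
doubleSum-cornerDifferences n c zeroBorder {i} {j} i≤n j≤n =
  sumTo-telescope i _ (λ a → c a j) (proj₁ (zeroBorder j j≤n)) (λ a<i → rowSum (ℕ.≤-trans a<i i≤n))
  where
  rowSum : ∀ {a} → a < n → sumTo j (entry n (cornerDifferences n c) (suc a)) ≡ c (suc a) j - c a j
  rowSum {a} a<n =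
    sumTo-telescope j _ (λ b → c (suc a) b - c a b) bottom (λ b<j → entry≡ (ℕ.≤-trans b<j j≤n))
    where
    bottom : c (suc a) 0 - c a 0 ≡ 0ℤ
    bottom rewrite proj₂ (zeroBorder (suc a) a<n) | proj₂ (zeroBorder a (ℕ.<⇒≤ a<n)) = refl

    entry≡ : ∀ {b} → b < n → entry n (cornerDifferences n c) (suc a) (suc b) ≡ secondDifference c a b
    entry≡ b<n = trans (entry-fromℕ< (cornerDifferences n c) a<n b<n)
                       (cong₂ (secondDifference c) (toℕ-fromℕ< a<n) (toℕ-fromℕ< b<n))

cornerDifferences-isMagog : ∀ n (C : CMatrix n) → IsMagogCornerSum n C →
                            IsMagog n (cornerDifferences n (centry n C))
cornerDifferences-isMagog n C (zeroBorder , identityBorder , rowIncrements , columnMonotone , convexity) =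
  (entrySigns , rowSums , colSums , colPartBits , rowPartNonneg) , special
  where
  c : ℕ → ℕ → ℤ
  c = centry n C
  A : Matrix n
  A = cornerDifferences n c
  open CornerSums A c (doubleSum-cornerDifferences n c zeroBorder)

  entrySigns : ∀ x y → IsSign (A x y)
  entrySigns x y = subst IsSign (sym (secondDifference-transpose c i j))
    (bit-difference-isSign (rowIncrements (suc i) (suc j) (toℕ<n x) (s≤s z≤n) (toℕ<n y))
                           (rowIncrements i (suc j) (ℕ.<⇒≤ (toℕ<n x)) (s≤s z≤n) (toℕ<n y)))
    where
    i = toℕ x
    j = toℕ y

  rowSums : ∀ i → 1 ≤ i → i ≤ n → rowPart n A i n ≡ 1ℤ
  rowSums (suc i) _ i<n = begin
    rowPart n A (suc i) n  ≡⟨ rowPart≡ i<n ℕ.≤-refl ⟩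
    c (suc i) n - c i n    ≡⟨ cong₂ _-_ (proj₂ (identityBorder (suc i) i<n))
                                        (proj₂ (identityBorder i (ℕ.<⇒≤ i<n))) ⟩
    + suc i - + i          ≡⟨ +[1+n]-+n≡1 i ⟩
    1ℤ                     ∎

  colSums : ∀ j → 1 ≤ j → j ≤ n → colPart n A n j ≡ 1ℤ
  colSums (suc j) _ j<n = begin
    colPart n A n (suc j)  ≡⟨ colPart≡ ℕ.≤-refl j<n ⟩
    c n (suc j) - c n j    ≡⟨ cong₂ _-_ (proj₁ (identityBorder (suc j) j<n))
                                        (proj₁ (identityBorder j (ℕ.<⇒≤ j<n))) ⟩
    + suc j - + j          ≡⟨ +[1+n]-+n≡1 j ⟩
    1ℤ                     ∎

  colPartBits : ∀ i j → 1 ≤ i → i ≤ n → 1 ≤ j → j ≤ n → IsBit (colPart n A i j)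
  colPartBits i (suc j) _ i≤n (s≤s z≤n) j<n =
    subst IsBit (sym (colPart≡ i≤n j<n)) (rowIncrements i (suc j) i≤n (s≤s z≤n) j<n)

  rowPartNonneg : ∀ i j → 1 ≤ i → i ≤ n → 1 ≤ j → j ≤ n → 0ℤ ℤ.≤ rowPart n A i j
  rowPartNonneg (suc i) j (s≤s z≤n) i<n _ j≤n =
    subst (0ℤ ℤ.≤_) (sym (rowPart≡ i<n j≤n))
          (ℤ.i≤j⇒0≤j-i (columnMonotone (suc i) j (s≤s z≤n) i<n j≤n))

  special : ∀ i j → 1 ≤ i → i ≤ n ∸ 2 → 1 ≤ j → j ≤ n ∸ 2 →
            0ℤ ℤ.≤ (rowPart n A (suc i) j + colPart n A (suc i) (suc j)) - colPart n A i j
  special i (suc j) 1≤i i≤n-2 1≤j j≤n-2 =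
    subst (0ℤ ℤ.≤_) (sym (specialExpression≡ (≤∸2⇒< 1≤i i≤n-2) (≤∸2⇒< 1≤j j≤n-2)))
          (ℤ.i≤j⇒0≤j-i (convexity i (suc j) 1≤i i≤n-2 1≤j j≤n-2))

cornerSum-cornerDifferences : ∀ n (C : CMatrix n) → IsMagogCornerSum n C →
                              cornerSum n (cornerDifferences n (centry n C)) ≐ᶜ C
cornerSum-cornerDifferences n C (zeroBorder , _) x y =
  trans (doubleSum-cornerDifferences n (centry n C) zeroBorder (ℕ.s≤s⁻¹ (toℕ<n x)) (ℕ.s≤s⁻¹ (toℕ<n y)))
        (centry-toℕ C x y)

lemma4p3 : (n : ℕ) → 1 ≤ n → CornerSumBijection n
lemma4p3 n _ = record
  { maps-into  = cornerSum-isMagogCornerSum n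
  ; injective  = λ A B _ _ → cornerSum-injective n A B
  ; surjective = λ C isCornerSum →
      cornerDifferences n (centry n C) ,
      cornerDifferences-isMagog n C isCornerSum ,
      cornerSum-cornerDifferences n C isCornerSum
  }
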